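{- Let $n\ge 1$ and let $T\in\mathbb{T}_n$ be an ordered tree, stored with each node $v$ carrying the value $l(v)$ and its children in their arranged order. Then $\mathit{NextTree}(T)$ runs in $O(n)$ time.
   Context: Let $\mathbb{T}$ be the set of finite rooted trees in which every internal node has at least two children. For a node $v$, $T(v)$ is the subtree rooted at $v$ and $l(v)$ the number of leaves of $T(v)$; $\mathbb{T}_n=\{T\in\mathbb{T}:l(\mathrm{root}(T))=n\}$. For an integer $p\ge 2$, $\mathrm{Part}(p)$ is the set of non-decreasing sequences $(a_1,\dots,a_k)$ of positive integers with $k\ge 2$ and $\sum_i a_i=p$, ordered lexicographically: for distinct $a=(a_i)_k$, $b=(b_i)_m$, let $j$ be the least index $\le\min\{k,m\}$ with $a_j\ne b_j$; then $a<b$ iff $a_j<b_j$. Its maximum is $(\lfloor p/2\rfloor,\lceil p/2\rceil)$. Node comparison: define, by induction on the number of leaves, a comparison between nodes $v,w$ with outcomes $v<w$, $v\sim w$, or $w<v$: (1) if $l(v)<l(w)$ then $v<w$ (symmetrically); (2) if $l(v)=l(w)=1$ then $v\sim w$; (3) if $l(v)=l(w)\ge 2$, list the children of $v$ as $v_1,\dots,v_k$ and those of $w$ as $w_1,\dots,w_m$, each list non-decreasing with respect to this comparison; $(l(v_1),\dots,l(v_k))$ and $(l(w_1),\dots,l(w_m))\in\mathrm{Part}(l(v))$ are the induced partitions. (3.1) If the partition induced by $v$ is lexicographically smaller (resp. larger) than that induced by $w$ then $v<w$ (resp. $w<v$). (3.2) If equal (so $k=m$): if $v_i\sim w_i$ for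 all $i$ then $v\sim w$; otherwise, with $j$ least such that $v_j\not\sim w_j$, $v<w$ if $v_j<w_j$ and $w<v$ otherwise. Write $v\le w$ if $v<w$ or $v\sim w$. An ordered tree is a tree in $\mathbb{T}$ together with, for every internal node, an arrangement of its children $v_1,\dots,v_k$ with $v_1\le\dots\le v_k$. The siblings of a non-root node $x$ after $x$ are the children of its parent arranged after $x$; the root has none. A node $v$ is exhausted if it is a leaf or its induced partition is the maximum of $\mathrm{Part}(l(v))$. The inverted post-order traversal traverses, for the root with children $v_1,\dots,v_k$ in their arrangement, $T(v_k),\dots,T(v_1)$ recursively and then visits the root. The pivot is the first visited node that is not exhausted, if any. Procedure $\mathit{NextTree}$, on input an ordered tree $T\in\mathbb{T}_n$: (i) find the pivot $v$ by inverted post-order traversal; if none, return null. (ii) Compute the element $b=(b_1,\dots,b_m)$ of $\mathrm{Part}(l(v))$ immediately next to the partition $a=(a_1,\dots,a_k)$ induced by $v$ using the following procedure $\mathit{NextPartition}$ (with $p=l(v)$): if $a_1\ne\lfloor p/2\rfloor$, then if $a_k-a_{k-1}\le1$ return $(a_1,\dots,a_{k-2},a_{k-1}+a_k)$, else with $c=a_{k-1}+1$, $d=a_k-1$, $q=\lfloor d/c\rfloor$, $r=d-qc$ return $(a_1,\dots,a_{k-2},c,\dots,c\ (q\text{ times}),c+r)$ if $q>1$ and $(a_1,\dots,a_{k-2},c,d)$ otherwise; if $a_1=\lfloor p/2\rfloor$, return null unless $p=3$ and $a_2\ne 2$, in which case return $(1,2)$. Replace $T(v)$ by the subtree in which $v$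 has children $u_1,\dots,u_m$ in this order, where $u_i$ is a leaf if $b_i=1$ and otherwise has exactly $b_i$ leaf children. (iii) Set $x:=v$ and repeat: for every sibling $y$ of $x$ after $x$, if $l(y)=l(x)$ replace $T(y)$ by a copy of the current $T(x)$, otherwise replace $T(y)$ by the tree in which $y$ has exactly $l(y)$ leaf children; then set $x$ to its parent; stop after the root has been processed. (iv) Return the resulting tree. -}

module Defs where

open import Data.Nat using (ℕ; zero; suc; _+_; _*_; _∸_; _≤_; _<ᵇ_; _≡ᵇ_; _≤ᵇ_)
open import Data.Nat.DivMod using (_/_)
open import Data.Bool using (Bool; true; false; if_then_else_; _∧_; not)
open import Data.List using (List; []; _∷_; map; sum; length; replicate; _++_)
open import Data.List.Relation.Unary.All using (All)
open import Data.List.Relation.Unary.Linked using (Linked)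
open import Data.Maybe using (Maybe; just; nothing)
open import Data.Product using (_×_; _,_; proj₁; proj₂)
open import Relation.Binary.PropositionalEquality using (_≡_; _≢_)

-- Trees, stored as in the paper: every node carries its value l(v)
-- and the list of its children in their arranged order.
-- A leaf is a node with no children.

data Tree : Set where
  nd : ℕ → List Tree → Tree

label : Tree → ℕ
label (nd l _) = l

children : Tree → List Tree
children (nd _ cs) = cs

mutual
  leaves : Tree → ℕ
  leaves (nd _ [])       = 1
  leaves (nd _ (c ∷ cs)) = leaves c + leavesL cs

  leavesL : List Tree → ℕ
  leavesL []       = 0
  leavesL (c ∷ cs) = leaves c + leavesL cs

mutual
  size : Tree → ℕ
  size (nd _ cs) = suc (sizeL cs)

  sizeL : List Tree → ℕ
  sizeL []       = 0
  sizeL (c ∷ cs) = size c + sizeL cs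

-- Well-formed: a tree of 𝕋 (every internal node has ≥ 2 children)
-- whose stored values are the true leaf counts l(v).
data WF : Tree → Set where
  wf-leaf : WF (nd 1 [])
  wf-node : ∀ {l cs} → 2 ≤ length cs → All WF cs → l ≡ leavesL cs → WF (nd l cs)

data Cmp : Set where
  lt eq gt : Cmp

thenCmp : Cmp → Cmp → Cmp
thenCmp eq d = d
thenCmp c  _ = c

cmpℕ : ℕ → ℕ → Cmp
cmpℕ m n = if m <ᵇ n then lt else (if n <ᵇ m then gt else eq)

lexℕ : List ℕ → List ℕ → Cmp
lexℕ []       []       = eq
lexℕ []       (_ ∷ _)  = lt
lexℕ (_ ∷ _)  []       = gt
lexℕ (x ∷ xs) (y ∷ ys) = thenCmp (cmpℕ x y) (lexℕ xs ys)

-- It is applied to trees whose children lists are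
-- already arranged non-decreasingly (see Ordered), so the listed children
-- are exactly the sorted children required by clause (3).
mutual
  cmp : Tree → Tree → Cmp
  cmp (nd a cs) (nd b ds) =
    thenCmp (cmpℕ (leaves (nd a cs)) (leaves (nd b ds)))
      (if leaves (nd a cs) ≡ᵇ 1 then eq
       else thenCmp (lexℕ (map leaves cs) (map leaves ds)) (cmpL cs ds))

  cmpL : List Tree → List Tree → Cmp
  cmpL []       []       = eq
  cmpL (x ∷ xs) (y ∷ ys) = thenCmp (cmp x y) (cmpL xs ys)
  cmpL _        _        = eq   -- unreachable: equal partitions have equal length

_≼_ : Tree → Tree → Set
v ≼ w = cmp v w ≢ gt

data Ordered : Tree → Set where
  ord : ∀ {l cs} → All Ordered cs → Linked _≼_ cs → Ordered (nd l cs)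

-- NextPartition (literal transcription), with p = l(v).

lastTwo : List ℕ → Maybe (List ℕ × ℕ × ℕ)
lastTwo []           = nothing
lastTwo (_ ∷ [])     = nothing
lastTwo (x ∷ y ∷ []) = just ([] , x , y)
lastTwo (x ∷ y ∷ z ∷ zs) with lastTwo (y ∷ z ∷ zs)
... | just (pre , u , w) = just (x ∷ pre , u , w)
... | nothing            = nothing

second : List ℕ → ℕ
second (_ ∷ y ∷ _) = y
second _           = 0

nextPartition : ℕ → List ℕ → Maybe (List ℕ)
nextPartition p [] = nothing
nextPartition p (a₁ ∷ as) =
  if not (a₁ ≡ᵇ (p / 2)) then step (lastTwo (a₁ ∷ as))
  else (if (p ≡ᵇ 3) ∧ not (second (a₁ ∷ as) ≡ᵇ 2) then just (1 ∷ 2 ∷ []) else nothing)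
  where
  step : Maybe (List ℕ × ℕ × ℕ) → Maybe (List ℕ)
  step nothing = nothing
  step (just (pre , aₖ₋₁ , aₖ)) =
    if (aₖ ∸ aₖ₋₁) ≤ᵇ 1 then just (pre ++ (aₖ₋₁ + aₖ ∷ []))
    else (if 1 <ᵇ q then just (pre ++ replicate q c ++ (c + r ∷ []))
          else just (pre ++ (c ∷ d ∷ [])))
    where
    c = suc aₖ₋₁
    d = aₖ ∸ 1
    q = d / c
    r = d ∸ q * c

-- NextTree, instrumented with an explicit step count.
--
-- Cost model (unit-cost operations on the stored representation):
--  * 1 per node visited by the inverted post-order traversal
--    (the exhaustion test at a node reads l(v) and the l-values of its
--    children, charged below only at the pivot; at other nodes it
--    reads O(1) values: the number of children and l of the first two);
--  * at the pivot: (number of children of v) + (length of b) for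
--    computing b by NextPartition, plus size of the new subtree built;
--  * step (iii): 1 per sibling y processed, plus the size of the
--    subtree written in place of T(y) (copy of T(x), or the flat tree).

leaf : Tree
leaf = nd 1 []

flat : ℕ → Tree
flat l = nd l (replicate l leaf)

build : ℕ → List ℕ → Tree
build p b = nd p (map (λ bᵢ → if bᵢ ≡ᵇ 1 then leaf else flat bᵢ) b)

maxPart : ℕ → List ℕ
maxPart p = (p / 2) ∷ (p ∸ p / 2) ∷ []

eqListℕ : List ℕ → List ℕ → Bool
eqListℕ []       []       = true
eqListℕ (x ∷ xs) (y ∷ ys) = (x ≡ᵇ y) ∧ eqListℕ xs ys
eqListℕ _        _        = false

exhausted : Tree → Bool
exhausted (nd _ [])       = true
exhausted (nd l (c ∷ cs)) = eqListℕ (map label (c ∷ cs)) (maxPart l)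

replaceSib : Tree → Tree → Tree
replaceSib x y = if label y ≡ᵇ label x then x else flat (label y)

replaceCost : Tree → List Tree → ℕ
replaceCost x []       = 0
replaceCost x (y ∷ ys) = suc (size (replaceSib x y)) + replaceCost x ys

-- result of processing a subtree: either no pivot found (with cost), or
-- the pivot was found inside and the updated subtree is returned (with cost)
data Res (A : Set) : Set where
  none  : ℕ → Res A
  found : A → ℕ → Res A

mutual
  go : Tree → Res Tree
  go (nd l cs) with goL cs
  ... | found cs' k = found (nd l cs') (suc k)
  ... | none k with exhausted (nd l cs)
  ...   | true  = none (suc k)
  ...   | false with nextPartition l (map label cs)
  ...     | just b  = found (build l b)
                        (suc k + length cs + length b + size (build l b))
  ...     | nothing = found (nd l cs) (suc k)   -- unreachable on 𝕋

  -- children are traversed last-to-first: the tail is processed first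
  goL : List Tree → Res (List Tree)
  goL []       = none 0
  goL (c ∷ cs) with goL cs
  ... | found cs' k = found (c ∷ cs') k
  ... | none k with go c
  ...   | none k'    = none (k + k')
  ...   | found c' k' = found (c' ∷ map (replaceSib c') cs)
                              (k + k' + replaceCost c' cs)

-- NextTree(T) : the resulting tree (nothing = null) ...
nextTree : Tree → Maybe Tree
nextTree t with go t
... | none _    = nothing
... | found t' _ = just t'

nextTreeCost : Tree → ℕ
nextTreeCost t with go t
... | none k    = k
... | found _ k = k

-- A tree of 𝕋 with n leaves has fewer than 2n nodes, so the inverted post-order
-- traversal up to the pivot v costs O(n). The partition following the one induced
-- by v has length plus sum at most 3(k + l(v)) + 5 for k children, so rebuilding
-- T(v) costs O(l(v)). In step (iii) each sibling y after x receives a tree with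
-- fewer than 10 l(y) nodes, and all these siblings together with v have pairwise
-- disjoint leaf sets. The step charged at each ancestor of v is paid for by the
-- traversal term, giving the invariant cost ≤ size + 21 l, hence cost ≤ 23 n.

module Submission where

open import Defs
open import Data.Bool using (true; false; T; _∧_; not; if_then_else_)
open import Data.List using (List; []; _∷_; [_]; map; length; replicate; _++_)
open import Data.List.Properties using (length-map; length-++)
open import Data.List.Relation.Unary.All as All using (All; []; _∷_)
open import Data.Maybe using (just; nothing)
open import Data.Nat
open import Data.Nat.ListAction using (sum)
open import Data.Nat.ListAction.Properties using (sum-++)
open import Data.Nat.DivMod using (_/_; m/n≤m; m/n*n≤m)
open import Data.Nat.Properties
open import Algebra.Properties.CommutativeSemigroup +-commutativeSemigroup using (interchange)
open import Data.Nat.Tactic.RingSolver using (solve-∀)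
open import Data.Product using (_×_; _,_; ∃-syntax)
open import Data.Unit using (tt)
open import Relation.Binary.PropositionalEquality using (_≡_; refl; sym; trans; cong; cong₂; subst)
open ≤-Reasoning

labelSum : List Tree → ℕ
labelSum cs = sum (map label cs)

1≤leaves : ∀ t → 1 ≤ leaves t
1≤leaves (nd _ [])       = ≤-refl
1≤leaves (nd _ (c ∷ cs)) = ≤-trans (1≤leaves c) (m≤m+n (leaves c) (leavesL cs))

length≤leavesL : ∀ cs → length cs ≤ leavesL cs
length≤leavesL []       = z≤n
length≤leavesL (c ∷ cs) = +-mono-≤ (1≤leaves c) (length≤leavesL cs)

label≡leaves : ∀ {t} → WF t → label t ≡ leaves t
label≡leaves wf-leaf                          = refl
label≡leaves (wf-node {cs = []}    () _ _)
label≡leaves (wf-node {cs = _ ∷ _} _  _ refl) = refl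

labelSum≡leavesL : ∀ {cs} → All WF cs → labelSum cs ≡ leavesL cs
labelSum≡leavesL []       = refl
labelSum≡leavesL (w ∷ ws) = cong₂ _+_ (label≡leaves w) (labelSum≡leavesL ws)

1≤label : ∀ {t} → WF t → 1 ≤ label t
1≤label {t} w = subst (1 ≤_) (sym (label≡leaves w)) (1≤leaves t)

length≤labelSum : ∀ {cs} → All WF cs → length cs ≤ labelSum cs
length≤labelSum {cs} ws = subst (length cs ≤_) (sym (labelSum≡leavesL ws)) (length≤leavesL cs)

-- Measured against the stored value: rebuilt subtrees need not lie in 𝕋.
Small : ℕ → Tree → Set
Small d t = size t < d * label t

Small-mono : ∀ {d e t} → d ≤ e → Small d t → Small e t
Small-mono {t = t} d≤e s = ≤-trans s (*-monoˡ-≤ (label t) d≤e)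

sizeL+length≤ : ∀ d {cs} → All (Small d) cs → sizeL cs + length cs ≤ d * labelSum cs
sizeL+length≤ d []       = z≤n
sizeL+length≤ d {c ∷ cs} (s ∷ ss) = begin
  size c + sizeL cs + suc (length cs)   ≡⟨ regroup (size c) (sizeL cs) (length cs) ⟩
  suc (size c) + (sizeL cs + length cs) ≤⟨ +-mono-≤ s (sizeL+length≤ d ss) ⟩
  d * label c + d * labelSum cs         ≡⟨ *-distribˡ-+ d (label c) (labelSum cs) ⟨
  d * labelSum (c ∷ cs)                 ∎
  where
  regroup : ∀ a b n → a + b + suc n ≡ suc a + (b + n)
  regroup = solve-∀

Small-node : ∀ d {l cs} → 2 ≤ length cs → All (Small d) cs → l ≡ labelSum cs → Small d (nd l cs)
Small-node d {cs = cs} 2≤length ss refl = begin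
  2 + sizeL cs         ≡⟨ +-comm 2 (sizeL cs) ⟩
  sizeL cs + 2         ≤⟨ +-monoʳ-≤ (sizeL cs) 2≤length ⟩
  sizeL cs + length cs ≤⟨ sizeL+length≤ d ss ⟩
  d * labelSum cs      ∎

mutual
  WF⇒Small : ∀ {t} → WF t → Small 2 t
  WF⇒Small wf-leaf                     = ≤-refl
  WF⇒Small (wf-node 2≤length ws refl) =
    Small-node 2 2≤length (All-WF⇒Small ws) (sym (labelSum≡leavesL ws))

  All-WF⇒Small : ∀ {cs} → All WF cs → All (Small 2) cs
  All-WF⇒Small []       = []
  All-WF⇒Small (w ∷ ws) = WF⇒Small w ∷ All-WF⇒Small ws

weight : List ℕ → ℕ
weight xs = length xs + sum xs

weight-∷ : ∀ x xs → weight (x ∷ xs) ≡ suc x + weight xs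
weight-∷ x xs = regroup (length xs) x (sum xs)
  where
  regroup : ∀ n x s → suc n + (x + s) ≡ suc x + (n + s)
  regroup = solve-∀

weight-++ : ∀ xs ys → weight (xs ++ ys) ≡ weight xs + weight ys
weight-++ xs ys = begin-equality
  length (xs ++ ys) + sum (xs ++ ys)        ≡⟨ cong₂ _+_ (length-++ xs) (sum-++ xs ys) ⟩
  length xs + length ys + (sum xs + sum ys) ≡⟨ interchange (length xs) (length ys) (sum xs) (sum ys) ⟩
  weight xs + weight ys                     ∎

weight-replicate : ∀ q c → weight (replicate q c) ≡ q + q * c
weight-replicate zero    c = refl
weight-replicate (suc q) c = begin-equality
  weight (c ∷ replicate q c)     ≡⟨ weight-∷ c (replicate q c) ⟩
  suc c + weight (replicate q c) ≡⟨ cong (suc c +_) (weight-replicate q c) ⟩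
  suc c + (q + q * c)            ≡⟨ regroup c q ⟩
  suc q + suc q * c              ∎
  where
  regroup : ∀ c q → suc c + (q + q * c) ≡ suc q + suc q * c
  regroup = solve-∀

lastTwo-just : ∀ xs {pre u w} → lastTwo xs ≡ just (pre , u , w) → xs ≡ pre ++ u ∷ w ∷ []
lastTwo-just []           ()
lastTwo-just (_ ∷ [])     ()
lastTwo-just (x ∷ y ∷ []) refl = refl
lastTwo-just (x ∷ y ∷ z ∷ zs) split with lastTwo (y ∷ z ∷ zs) in split′
lastTwo-just (x ∷ y ∷ z ∷ zs) () | nothing
lastTwo-just (x ∷ y ∷ z ∷ zs) refl | just _ = cong (x ∷_) (lastTwo-just (y ∷ z ∷ zs) split′)

weight-spliceLastTwo : ∀ xs {pre u w} t → lastTwo xs ≡ just (pre , u , w) →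
                       weight t ≤ 3 * weight (u ∷ w ∷ []) → weight (pre ++ t) ≤ 3 * weight xs
weight-spliceLastTwo xs {pre} {u} {w} t split t≤ = begin
  weight (pre ++ t)                        ≡⟨ weight-++ pre t ⟩
  weight pre + weight t                    ≤⟨ +-mono-≤ (m≤n*m (weight pre) 3) t≤ ⟩
  3 * weight pre + 3 * weight (u ∷ w ∷ []) ≡⟨ *-distribˡ-+ 3 (weight pre) _ ⟨
  3 * (weight pre + weight (u ∷ w ∷ []))   ≡⟨ cong (3 *_) (weight-++ pre (u ∷ w ∷ [])) ⟨
  3 * weight (pre ++ u ∷ w ∷ [])           ≡⟨ cong (λ ys → 3 * weight ys) (lastTwo-just xs split) ⟨
  3 * weight xs                            ∎

weight-merge : ∀ u w → weight [ u + w ] ≤ 3 * weight (u ∷ w ∷ [])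
weight-merge u w = begin
  1 + (u + w + 0)                     ≤⟨ m≤m+n _ (5 + 2 * (u + w)) ⟩
  1 + (u + w + 0) + (5 + 2 * (u + w)) ≡⟨ regroup u w ⟩
  3 * (2 + (u + (w + 0)))             ∎
  where
  regroup : ∀ u w → 1 + (u + w + 0) + (5 + 2 * (u + w)) ≡ 3 * (2 + (u + (w + 0)))
  regroup = solve-∀

weight-divide : ∀ u w → let c = suc u; d = w ∸ 1; q = d / c in
                weight (replicate q c ++ [ c + (d ∸ q * c) ]) ≤ 3 * weight (u ∷ w ∷ [])
weight-divide u w = begin
  weight (replicate q c ++ [ c + r ])       ≡⟨ weight-++ (replicate q c) [ c + r ] ⟩
  weight (replicate q c) + weight [ c + r ] ≡⟨ cong (_+ weight [ c + r ]) (weight-replicate q c) ⟩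
  q + q * c + (1 + (c + r + 0))
    ≤⟨ +-mono-≤ (+-mono-≤ q≤w qc≤w) (+-monoʳ-≤ 1 (+-monoˡ-≤ 0 (+-monoʳ-≤ c r≤w))) ⟩
  w + w + (1 + (c + w + 0))                 ≤⟨ m≤m+n _ (4 + 2 * u) ⟩
  w + w + (1 + (c + w + 0)) + (4 + 2 * u)   ≡⟨ regroup u w ⟩
  3 * (2 + (u + (w + 0)))                   ∎
  where
  c = suc u
  d = w ∸ 1
  q = d / c
  r = d ∸ q * c
  d≤w : d ≤ w
  d≤w = m∸n≤m w 1
  q≤w : q ≤ w
  q≤w = ≤-trans (m/n≤m d c) d≤w
  qc≤w : q * c ≤ w
  qc≤w = ≤-trans (m/n*n≤m d c) d≤w
  r≤w : r ≤ w
  r≤w = ≤-trans (m∸n≤m d (q * c)) d≤w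
  regroup : ∀ u w → w + w + (1 + (suc u + w + 0)) + (4 + 2 * u) ≡ 3 * (2 + (u + (w + 0)))
  regroup = solve-∀

weight-shift : ∀ u w → weight (suc u ∷ w ∸ 1 ∷ []) ≤ 3 * weight (u ∷ w ∷ [])
weight-shift u w = begin
  2 + (suc u + (w ∸ 1 + 0))                 ≤⟨ +-monoʳ-≤ 2 (+-monoʳ-≤ (suc u) (+-monoˡ-≤ 0 (m∸n≤m w 1))) ⟩
  2 + (suc u + (w + 0))                     ≤⟨ m≤m+n _ (3 + 2 * (u + w)) ⟩
  2 + (suc u + (w + 0)) + (3 + 2 * (u + w)) ≡⟨ regroup u w ⟩
  3 * (2 + (u + (w + 0)))                   ∎
  where
  regroup : ∀ u w → 2 + (suc u + (w + 0)) + (3 + 2 * (u + w)) ≡ 3 * (2 + (u + (w + 0)))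
  regroup = solve-∀

-- The 5 is the weight of (1,2), returned when p = 3.
weight-nextPartition : ∀ p a {b} → nextPartition p a ≡ just b → weight b ≤ 3 * weight a + 5
weight-nextPartition p [] ()
weight-nextPartition p (a₁ ∷ as) next with a₁ ≡ᵇ p / 2
weight-nextPartition p (a₁ ∷ as) next | true with (p ≡ᵇ 3) ∧ not (second (a₁ ∷ as) ≡ᵇ 2)
weight-nextPartition p (a₁ ∷ as) refl | true | true  = m≤n+m 5 (3 * weight (a₁ ∷ as))
weight-nextPartition p (a₁ ∷ as) ()   | true | false
weight-nextPartition p (a₁ ∷ as) next | false with lastTwo (a₁ ∷ as) in split
weight-nextPartition p (a₁ ∷ as) ()   | false | nothing
weight-nextPartition p (a₁ ∷ as) next | false | just (pre , u , w) with (w ∸ u) ≤ᵇ 1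
weight-nextPartition p (a₁ ∷ as) refl | false | just (pre , u , w) | true =
  ≤-trans (weight-spliceLastTwo (a₁ ∷ as) _ split (weight-merge u w)) (m≤m+n _ 5)
weight-nextPartition p (a₁ ∷ as) next | false | just (pre , u , w) | false with 1 <ᵇ (w ∸ 1) / suc u
weight-nextPartition p (a₁ ∷ as) refl | false | just (pre , u , w) | false | true  =
  ≤-trans (weight-spliceLastTwo (a₁ ∷ as) _ split (weight-divide u w)) (m≤m+n _ 5)
weight-nextPartition p (a₁ ∷ as) refl | false | just (pre , u , w) | false | false =
  ≤-trans (weight-spliceLastTwo (a₁ ∷ as) _ split (weight-shift u w)) (m≤m+n _ 5)

sizeL-replicate-leaf : ∀ m → sizeL (replicate m leaf) ≡ m
sizeL-replicate-leaf zero    = refl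
sizeL-replicate-leaf (suc m) = cong suc (sizeL-replicate-leaf m)

Small-flat : ∀ {l} → 1 ≤ l → Small 3 (flat l)
Small-flat {suc m} _ = begin
  suc (suc (sizeL (replicate (suc m) leaf))) ≡⟨ cong (2 +_) (sizeL-replicate-leaf (suc m)) ⟩
  3 + m                                      ≤⟨ +-monoʳ-≤ 3 (m≤m*n m 3) ⟩
  suc m * 3                                  ≡⟨ *-comm (suc m) 3 ⟩
  3 * suc m                                  ∎

size-build : ∀ p b → size (build p b) ≤ suc (weight b)
size-build p b = s≤s (sizeL-parts b)
  where
  part : ℕ → Tree
  part bᵢ = if bᵢ ≡ᵇ 1 then leaf else flat bᵢ

  size-part : ∀ bᵢ → size (part bᵢ) ≤ suc bᵢ
  size-part bᵢ with bᵢ ≡ᵇ 1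
  ... | true  = s≤s z≤n
  ... | false = s≤s (≤-reflexive (sizeL-replicate-leaf bᵢ))

  sizeL-parts : ∀ b → sizeL (map part b) ≤ weight b
  sizeL-parts []       = z≤n
  sizeL-parts (x ∷ xs) = begin
    size (part x) + sizeL (map part xs) ≤⟨ +-mono-≤ (size-part x) (sizeL-parts xs) ⟩
    suc x + weight xs                   ≡⟨ weight-∷ x xs ⟨
    weight (x ∷ xs)                     ∎

label-replaceSib : ∀ x y → label (replaceSib x y) ≡ label y
label-replaceSib x y with label y ≡ᵇ label x in same
... | true  = sym (≡ᵇ⇒≡ (label y) (label x) (subst T (sym same) tt))
... | false = refl

labels-replaceSib : ∀ x ys → map label (map (replaceSib x) ys) ≡ map label ys
labels-replaceSib x []       = refl
labels-replaceSib x (y ∷ ys) = cong₂ _∷_ (label-replaceSib x y) (labels-replaceSib x ys)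

Small-replaceSib : ∀ d {x y} → 3 ≤ d → Small d x → 1 ≤ label y → Small d (replaceSib x y)
Small-replaceSib d {x} {y} 3≤d small 1≤l with label y ≡ᵇ label x
... | true  = small
... | false = Small-mono {t = flat (label y)} 3≤d (Small-flat 1≤l)

All-Small-replaceSib : ∀ d {x ys} → 3 ≤ d → Small d x → All (λ y → 1 ≤ label y) ys →
                       All (Small d) (map (replaceSib x) ys)
All-Small-replaceSib d 3≤d small []                   = []
All-Small-replaceSib d {ys = y ∷ _} 3≤d small (p ∷ ps) =
  Small-replaceSib d {y = y} 3≤d small p ∷ All-Small-replaceSib d 3≤d small ps

replaceCost≡ : ∀ x ys → let rs = map (replaceSib x) ys in replaceCost x ys ≡ sizeL rs + length rs
replaceCost≡ x []       = refl
replaceCost≡ x (y ∷ ys) = begin-equality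
  suc (size r) + replaceCost x ys        ≡⟨ cong (suc (size r) +_) (replaceCost≡ x ys) ⟩
  suc (size r) + (sizeL rs + length rs) ≡⟨ regroup (size r) (sizeL rs) (length rs) ⟩
  size r + sizeL rs + suc (length rs)    ∎
  where
  r  = replaceSib x y
  rs = map (replaceSib x) ys
  regroup : ∀ a b n → suc a + (b + n) ≡ a + b + suc n
  regroup = solve-∀

replaceCost≤ : ∀ d {x ys} → 3 ≤ d → Small d x → All (λ y → 1 ≤ label y) ys →
               replaceCost x ys ≤ d * labelSum ys
replaceCost≤ d {x} {ys} 3≤d small ps = begin
  replaceCost x ys     ≡⟨ replaceCost≡ x ys ⟩
  sizeL rs + length rs ≤⟨ sizeL+length≤ d (All-Small-replaceSib d 3≤d small ps) ⟩
  d * labelSum rs      ≡⟨ cong (λ ls → d * sum ls) (labels-replaceSib x ys) ⟩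
  d * labelSum ys      ∎
  where
  rs = map (replaceSib x) ys

GoBound : Tree → Res Tree → Set
GoBound t (none k)     = k ≤ size t
GoBound t (found t′ k) = k ≤ size t + 21 * label t × Small 10 t′ × label t′ ≡ label t

GoLBound : List Tree → Res (List Tree) → Set
GoLBound cs (none k)      = k ≤ sizeL cs
GoLBound cs (found cs′ k) =
  k ≤ sizeL cs + 21 * labelSum cs × All (Small 10) cs′ × map label cs′ ≡ map label cs

3≤10 : 3 ≤ 10
3≤10 = m≤m+n 3 7

2≤10 : 2 ≤ 10
2≤10 = m≤m+n 2 8

GoBound-pivot : ∀ {l cs k b} → WF (nd l cs) → k ≤ sizeL cs → nextPartition l (map label cs) ≡ just b →
                GoBound (nd l cs) (found (build l b) (suc k + length cs + length b + size (build l b)))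
GoBound-pivot {l} {cs} {k} {b} (wf-node 2≤length ws l≡) k≤ next = cost , small , refl
  where
  labelSum≡l : labelSum cs ≡ l
  labelSum≡l = trans (labelSum≡leavesL ws) (sym l≡)

  length≤l : length cs ≤ l
  length≤l = subst (length cs ≤_) labelSum≡l (length≤labelSum ws)

  2≤l : 2 ≤ l
  2≤l = ≤-trans 2≤length length≤l

  weight-b+2≤ : weight b + 2 ≤ 10 * l
  weight-b+2≤ = begin
    weight b + 2                       ≤⟨ +-monoˡ-≤ 2 (weight-nextPartition l (map label cs) next) ⟩
    3 * weight (map label cs) + 5 + 2  ≡⟨ +-assoc (3 * weight (map label cs)) 5 2 ⟩
    3 * weight (map label cs) + 7      ≡⟨ cong (λ m → 3 * (m + labelSum cs) + 7) (length-map label cs) ⟩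
    3 * (length cs + labelSum cs) + 7  ≤⟨ +-monoˡ-≤ 7 (*-monoʳ-≤ 3 (+-mono-≤ length≤l (≤-reflexive labelSum≡l))) ⟩
    3 * (l + l) + 7                    ≤⟨ +-monoʳ-≤ (3 * (l + l)) (≤-trans (m≤m+n 7 1) (*-monoʳ-≤ 4 2≤l)) ⟩
    3 * (l + l) + 4 * l                ≡⟨ regroup l ⟩
    10 * l                             ∎
    where
    regroup : ∀ l → 3 * (l + l) + 4 * l ≡ 10 * l
    regroup = solve-∀

  small : Small 10 (build l b)
  small = ≤-trans (s≤s (size-build l b)) (≤-trans (≤-reflexive (+-comm 2 (weight b))) weight-b+2≤)

  length-b≤ : length b ≤ 10 * l
  length-b≤ = ≤-trans (m≤m+n (length b) (sum b)) (m+n≤o⇒m≤o (weight b) weight-b+2≤)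

  cost : suc k + length cs + length b + size (build l b) ≤ suc (sizeL cs) + 21 * l
  cost = begin
    suc k + length cs + length b + size (build l b)
      ≤⟨ +-mono-≤ (+-mono-≤ (+-mono-≤ (s≤s k≤) length≤l) length-b≤) (<⇒≤ small) ⟩
    suc (sizeL cs) + l + 10 * l + 10 * l ≡⟨ regroup (suc (sizeL cs)) l ⟩
    suc (sizeL cs) + 21 * l              ∎
    where
    regroup : ∀ s l → s + l + 10 * l + 10 * l ≡ s + 21 * l
    regroup = solve-∀

GoBound-descend : ∀ {l cs cs′ k} → labelSum cs ≡ l → 2 ≤ length cs → GoLBound cs (found cs′ k) →
                  GoBound (nd l cs) (found (nd l cs′) (suc k))
GoBound-descend {l} {cs} {cs′} refl 2≤length (k≤ , small , labels) =
  s≤s k≤ , Small-node 10 2≤length′ small (cong sum (sym labels)) , refl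
  where
  2≤length′ : 2 ≤ length cs′
  2≤length′ = begin
    2                      ≤⟨ 2≤length ⟩
    length cs              ≡⟨ length-map label cs ⟨
    length (map label cs)  ≡⟨ cong length labels ⟨
    length (map label cs′) ≡⟨ length-map label cs′ ⟩
    length cs′             ∎

GoLBound-later : ∀ {c cs cs′ k} → WF c → GoLBound cs (found cs′ k) → GoLBound (c ∷ cs) (found (c ∷ cs′) k)
GoLBound-later {c} {cs} w (k≤ , small , labels) =
  ≤-trans k≤ (+-mono-≤ (m≤n+m (sizeL cs) (size c)) (*-monoʳ-≤ 21 (m≤n+m (labelSum cs) (label c)))) ,
  Small-mono {t = c} 2≤10 (WF⇒Small w) ∷ small ,
  cong (label c ∷_) labels

GoLBound-here : ∀ {c c′ cs k k′} → All WF cs → k ≤ sizeL cs → GoBound c (found c′ k′) →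
                GoLBound (c ∷ cs) (found (c′ ∷ map (replaceSib c′) cs) (k + k′ + replaceCost c′ cs))
GoLBound-here {c} {c′} {cs} {k} {k′} ws k≤ (k′≤ , small , label≡) =
  cost , small ∷ All-Small-replaceSib 10 3≤10 small positive ,
  cong₂ _∷_ label≡ (labels-replaceSib c′ cs)
  where
  positive : All (λ y → 1 ≤ label y) cs
  positive = All.map 1≤label ws

  cost : k + k′ + replaceCost c′ cs ≤ size c + sizeL cs + 21 * (label c + labelSum cs)
  cost = begin
    k + k′ + replaceCost c′ cs
      ≤⟨ +-mono-≤ (+-mono-≤ k≤ k′≤) (replaceCost≤ 10 3≤10 small positive) ⟩
    sizeL cs + (size c + 21 * label c) + 10 * labelSum cs
      ≤⟨ +-monoʳ-≤ (sizeL cs + (size c + 21 * label c)) (*-monoˡ-≤ (labelSum cs) (m≤m+n 10 11)) ⟩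
    sizeL cs + (size c + 21 * label c) + 21 * labelSum cs
      ≡⟨ regroup (sizeL cs) (size c) (label c) (labelSum cs) ⟩
    size c + sizeL cs + 21 * (label c + labelSum cs)
      ∎
    where
    regroup : ∀ s s′ l l′ → s + (s′ + 21 * l) + 21 * l′ ≡ s′ + s + 21 * (l + l′)
    regroup = solve-∀

mutual
  go-bound : ∀ {t} → WF t → GoBound t (go t)
  go-bound wf-leaf = ≤-refl
  go-bound {nd l cs} w@(wf-node 2≤length ws l≡) with goL cs | goL-bound ws
  ... | found cs′ k | below =
    GoBound-descend (trans (labelSum≡leavesL ws) (sym l≡)) 2≤length below
  ... | none k | k≤ with exhausted (nd l cs)
  ...   | true  = s≤s k≤
  ...   | false with nextPartition l (map label cs) in next
  ...     | just b  = GoBound-pivot w k≤ next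
  ...     | nothing =
    s≤s (≤-trans k≤ (m≤m+n (sizeL cs) _)) , Small-mono {t = nd l cs} 2≤10 (WF⇒Small w) , refl

  goL-bound : ∀ {cs} → All WF cs → GoLBound cs (goL cs)
  goL-bound [] = z≤n
  goL-bound {c ∷ cs} (w ∷ ws) with goL cs | goL-bound ws
  ... | found cs′ k | later = GoLBound-later w later
  ... | none k | k≤ with go c | go-bound w
  ...   | none k′ | k′≤ = ≤-trans (+-mono-≤ k≤ k′≤) (≤-reflexive (+-comm (sizeL cs) (size c)))
  ...   | found c′ k′ | here = GoLBound-here {c} ws k≤ here

nextTreeCost≤ : ∀ {t} → WF t → nextTreeCost t ≤ size t + 21 * label t
nextTreeCost≤ {t} w with go t | go-bound w
... | none k    | k≤     = ≤-trans k≤ (m≤m+n (size t) _)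
... | found _ k | k≤ , _ = k≤

corollary2 : ∃[ c ] ((n : ℕ) → 1 ≤ n → (T : Tree) → WF T → Ordered T →
    leaves T ≡ n → nextTreeCost T ≤ c * n)
corollary2 = 23 , λ n _ T w _ leaves≡n → begin
  nextTreeCost T             ≤⟨ nextTreeCost≤ w ⟩
  size T + 21 * label T      ≤⟨ +-monoˡ-≤ (21 * label T) (<⇒≤ (WF⇒Small w)) ⟩
  2 * label T + 21 * label T ≡⟨ *-distribʳ-+ (label T) 2 21 ⟨
  23 * label T               ≡⟨ cong (23 *_) (trans (label≡leaves w) leaves≡n) ⟩
  23 * n                     ∎
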